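{- Let $\mathbb{F}$ be a field. Let $\Phi$ be an $n$-variate arithmetic circuit of fan-in two and size $s$, let $\vec\alpha\in\mathbb{F}^n$, $\beta\in\mathbb{F}$, and let $\mathcal{G}$ be the local encoding of $\Phi(\vec\alpha)=\beta$, with variables $x_1,\ldots,x_n,y_1,\ldots,y_s$. For every $k\in[s]$ there is a multi-output arithmetic circuit $\Psi_k$ such that: the size of $\Psi_k$ is $O(k)$; and $\Psi_k$ outputs $k$ polynomials $h_1,\ldots,h_k \in \mathbb{F}[z_1,\ldots,z_{n+s+1}]$ that depend only on $z_1,\ldots,z_{n+k}$, and for each $i\in[k]$, $h_i(\mathcal{G}(\vec x,\vec y)) = y_i$.
   Context: An arithmetic circuit has input gates labeled by variables or field constants and internal gates labeled $+$ or $\times$; size is the number of internal gates. Local encoding: for an $n$-variate arithmetic circuit $\Phi$ of fan-in two and size $s$, $\vec\alpha\in\mathbb{F}^n$, $\beta\in\mathbb{F}$, the local encoding of $\Phi(\vec\alpha)=\beta$ is the polynomial map $\mathcal{G}:\mathbb{F}^{n+s}\to\mathbb{F}^{n+s+1}$ in variables $x_1,\ldots,x_n,y_1,\ldots,y_s$ whose outputs are, in order: (i) $x_1-\alpha_1,\ldots,x_n-\alpha_n$; (ii) for a fixed topological ordering $v_1,\ldots,v_s$ of the internal gates with $v_s$ the output gate, and with $L(v)=\gamma$ if $v$ is an input gate labeled by constant $\gamma$, $L(v)=x_i$ if $v$ is an input gate labeled $x_i$, $L(v)=y_i$ if $v=v_i$: the $i$-th of these $s$ outputs is $L(v_i)-(L(u)+L(w))$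 if $v_i$ is an addition gate with children $u,w$, and $L(v_i)-L(u)L(w)$ if $v_i$ is a multiplication gate with children $u,w$; (iii) $y_s-\beta$. Composition $h(\mathcal{G}(\vec x,\vec y))$ means substituting the $j$-th output of $\mathcal{G}$ for $z_j$. -}

module Defs where

open import Level using (Level; _⊔_; Setω) renaming (suc to lsuc)
open import Data.Nat using (ℕ; zero; suc; _+_; _<_)
open import Data.Fin using (Fin; toℕ; fromℕ; inject₁; _↑ˡ_; _↑ʳ_)
open import Data.Vec using (Vec; map; []; _∷_; _∷ʳ_; _++_; lookup; tabulate)
open import Data.Product using (∃; _×_; _,_)
open import Relation.Nullary using (¬_)
open import Algebra.Bundles using (CommutativeRing)

record Field (c ℓ : Level) : Set (lsuc (c ⊔ ℓ)) where
  field
    commutativeRing : CommutativeRing c ℓ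
  open CommutativeRing commutativeRing public
  field
    0≉1     : ¬ (0# ≈ 1#)
    inverse : ∀ x → ¬ (x ≈ 0#) → ∃ λ y → (x * y) ≈ 1#

-- A Σ-type with a natural-number first component and a Setω body
-- (used for "there is an absolute constant C such that for all fields …").

record ∃ℕω (P : ℕ → Setω) : Setω where
  constructor _,_
  field
    witness : ℕ
    proof   : P witness

module _ {c ℓ : Level} (F : Field c ℓ) where
  open Field F using (Carrier; _≈_; 0#; 1#; -_) renaming (_+_ to _+F_; _*_ to _*F_)

  -- Polynomials F[z_0, …, z_{m-1}]: terms built from constants and
  -- variables by + and ×, identified by the commutative F-algebra
  -- congruence _~_ below (i.e. F[z] as the free commutative F-algebra).

  infixl 6 _⊕_
  infixl 7 _⊗_

  data Poly (m : ℕ) : Set c where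
    con  : Carrier → Poly m
    var  : Fin m → Poly m
    _⊕_  : Poly m → Poly m → Poly m
    _⊗_  : Poly m → Poly m → Poly m

  _⊖_ : ∀ {m} → Poly m → Poly m → Poly m
  p ⊖ q = p ⊕ (con (- 1#) ⊗ q)

  infix 4 _~_

  data _~_ {m : ℕ} : Poly m → Poly m → Set (c ⊔ ℓ) where
    ~-refl  : ∀ {p} → p ~ p
    ~-sym   : ∀ {p q} → p ~ q → q ~ p
    ~-trans : ∀ {p q r} → p ~ q → q ~ r → p ~ r
    ⊕-cong  : ∀ {p p′ q q′} → p ~ p′ → q ~ q′ → p ⊕ q ~ p′ ⊕ q′
    ⊗-cong  : ∀ {p p′ q q′} → p ~ p′ → q ~ q′ → p ⊗ q ~ p′ ⊗ q′
    ⊕-assoc : ∀ p q r → (p ⊕ q) ⊕ r ~ p ⊕ (q ⊕ r)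
    ⊕-comm  : ∀ p q → p ⊕ q ~ q ⊕ p
    ⊕-idˡ   : ∀ p → con 0# ⊕ p ~ p
    ⊕-invʳ  : ∀ p → p ⊕ (con (- 1#) ⊗ p) ~ con 0#
    ⊗-assoc : ∀ p q r → (p ⊗ q) ⊗ r ~ p ⊗ (q ⊗ r)
    ⊗-comm  : ∀ p q → p ⊗ q ~ q ⊗ p
    ⊗-idˡ   : ∀ p → con 1# ⊗ p ~ p
    distribˡ : ∀ p q r → p ⊗ (q ⊕ r) ~ (p ⊗ q) ⊕ (p ⊗ r)
    con-cong : ∀ {a b} → a ≈ b → con a ~ con b
    con-+    : ∀ a b → con a ⊕ con b ~ con (a +F b)
    con-*    : ∀ a b → con a ⊗ con b ~ con (a *F b)

  subst : ∀ {m k} → Poly m → (Fin m → Poly k) → Poly k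
  subst (con a) σ = con a
  subst (var i) σ = σ i
  subst (p ⊕ q) σ = subst p σ ⊕ subst q σ
  subst (p ⊗ q) σ = subst p σ ⊗ subst q σ

  data OnlyVarsBelow {m : ℕ} (j : ℕ) : Poly m → Set c where
    con : ∀ a → OnlyVarsBelow j (con a)
    var : ∀ i → toℕ i < j → OnlyVarsBelow j (var i)
    _⊕_ : ∀ {p q} → OnlyVarsBelow j p → OnlyVarsBelow j q → OnlyVarsBelow j (p ⊕ q)
    _⊗_ : ∀ {p q} → OnlyVarsBelow j p → OnlyVarsBelow j q → OnlyVarsBelow j (p ⊗ q)

  DependsOnlyOnFirst : ∀ {m} → ℕ → Poly m → Set (c ⊔ ℓ)
  DependsOnlyOnFirst j p = ∃ λ q → OnlyVarsBelow j q × (p ~ q)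

  -- A circuit of size m is the list of its m internal gates in a
  -- topological order; a child of the internal gate number i is an
  -- input gate (variable x_j or a field constant) or an internal gate
  -- with index < i.  The last gate is the output gate.

  data Node (n m : ℕ) : Set c where
    inp  : Fin n → Node n m
    cst  : Carrier → Node n m
    gate : Fin m → Node n m

  data Gate (n m : ℕ) : Set c where
    plus  : Node n m → Node n m → Gate n m
    times : Node n m → Node n m → Gate n m

  data Circuit (n : ℕ) : ℕ → Set c where
    []  : Circuit n 0
    _▷_ : ∀ {m} → Circuit n m → Gate n m → Circuit n (suc m)

  label : ∀ {n m k} → (Fin n → Poly k) → (Fin m → Poly k) → Node n m → Poly k
  label ρ σ (inp j)  = ρ j
  label ρ σ (cst a)  = con a
  label ρ σ (gate j) = σ j

  gateExpr : ∀ {n m k} → (Fin n → Poly k) → (Fin m → Poly k) → Gate n m → Poly k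
  gateExpr ρ σ (plus u w)  = label ρ σ u ⊕ label ρ σ w
  gateExpr ρ σ (times u w) = label ρ σ u ⊗ label ρ σ w

  gatePolys : ∀ {n m} → Circuit n m → Vec (Poly n) m
  gatePolys []      = []
  gatePolys (C ▷ g) = gatePolys C ∷ʳ gateExpr var (lookup (gatePolys C)) g

  nodePoly : ∀ {n m} → Circuit n m → Node n m → Poly n
  nodePoly C = label var (lookup (gatePolys C))

  record MultiCircuit (N k : ℕ) : Set c where
    field
      size    : ℕ
      gates   : Circuit N size
      outputs : Vec (Node N size) k

  outputPolys : ∀ {N k} → MultiCircuit N k → Vec (Poly N) k
  outputPolys Ψ = map (nodePoly gates) outputs
    where open MultiCircuit Ψ

  -- Local encoding.  Variables of F[x,y]: x_j ↦ var (j ↑ˡ s),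
  -- y_i ↦ var (n ↑ʳ i)   (0-based indices).

  -- gate equations  L(v_i) - (L(u) ⊙ L(w)),  i = 0 … m-1,  where σ gives
  -- the y-variables of the gates
  gateEqs : ∀ {n m k} → (Fin n → Poly k) → Circuit n m → (Fin m → Poly k) → Vec (Poly k) m
  gateEqs ρ []      σ = []
  gateEqs ρ (C ▷ g) σ =
    gateEqs ρ C (λ j → σ (inject₁ j)) ∷ʳ (σ (fromℕ _) ⊖ gateExpr ρ (λ j → σ (inject₁ j)) g)

  -- local encoding G of Φ(α) = β for a circuit of size s = suc s′,
  -- as the list of its n + s + 1 output polynomials in n + s variables
  localEncoding : ∀ {n s} → Circuit n (suc s) → Vec Carrier n → Carrier
                → Vec (Poly (n + suc s)) (n + suc s + 1)
  localEncoding {n} {s} Φ α β =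
    (tabulate (λ j → x j ⊖ con (lookup α j)) ++ gateEqs x Φ y)
      ++ ((y (fromℕ s) ⊖ con β) ∷ [])
    where
      x : Fin n → Poly (n + suc s)
      x j = var (j ↑ˡ suc s)
      y : Fin (suc s) → Poly (n + suc s)
      y i = var (n ↑ʳ i)

-- Process the gates in topological order, keeping for every gate v_i a
-- polynomial h_i in the z's with h_i ∘ G = y_i.  For an input x_j,
-- z_j + α_j decodes to x_j; the gate equation of v_i is
-- z_{n+i} = y_i − (L(u) ⊙ L(w)), so  h_i := z_{n+i} + (h_u ⊙ h_w)  decodes
-- to y_i once h_u and h_w decode to L(u) and L(w).  Each gate costs four
-- new gates (two to decode the children, one for ⊙, one for the addition),
-- and h_i only involves z_1, …, z_n and z_{n+1}, …, z_{n+i}.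
module Submission where

open import Defs
open import Data.Nat using (ℕ; suc; _+_; _*_; _≤_)
open import Data.Fin using (Fin; inject≤; _↑ʳ_)
open import Data.Vec using (Vec; lookup)
open import Data.Product using (Σ; _×_)

open import Level using (Level; _⊔_)
open import Data.Nat using (_<_; _≤′_; ≤′-refl; ≤′-step)
open import Data.Nat.Properties using (≤⇒≤′; *-comm; ≤-reflexive; m≤m+n; +-monoʳ-<; <-≤-trans)
open import Data.Fin using (zero; suc; toℕ; fromℕ; inject₁; _↑ˡ_)
open import Data.Fin.Properties using (toℕ-injective; toℕ-inject₁; toℕ-inject≤; toℕ-↑ˡ; toℕ-↑ʳ; toℕ<n)
open import Data.Fin.Relation.Unary.Top using (view; ‵fromℕ; ‵inject₁)
open import Data.Vec using ([]; _∷_; _∷ʳ_; _++_; map; tabulate)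
open import Data.Vec.Properties using (lookup-map; lookup-++ˡ; lookup-++ʳ; lookup∘tabulate)
open import Data.Product using (_,_)
open import Relation.Binary.Bundles using (Setoid)
open import Relation.Binary.PropositionalEquality using (_≡_; refl; sym; trans; cong; cong₂)
import Relation.Binary.Reasoning.Setoid as SetoidReasoning

lookup-∷ʳ-inject₁ : ∀ {a} {A : Set a} {m} (xs : Vec A m) (x : A) (i : Fin m) →
                    lookup (xs ∷ʳ x) (inject₁ i) ≡ lookup xs i
lookup-∷ʳ-inject₁ (y ∷ xs) x zero    = refl
lookup-∷ʳ-inject₁ (y ∷ xs) x (suc i) = lookup-∷ʳ-inject₁ xs x i

lookup-∷ʳ-fromℕ : ∀ {a} {A : Set a} {m} (xs : Vec A m) (x : A) →
                  lookup (xs ∷ʳ x) (fromℕ m) ≡ x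
lookup-∷ʳ-fromℕ []       x = refl
lookup-∷ʳ-fromℕ (y ∷ xs) x = lookup-∷ʳ-fromℕ xs x

inject≤′ : ∀ {k m} → Fin k → k ≤′ m → Fin m
inject≤′ i ≤′-refl          = i
inject≤′ i (≤′-step k≤′m) = inject₁ (inject≤′ i k≤′m)

toℕ-inject≤′ : ∀ {k m} (i : Fin k) (k≤′m : k ≤′ m) → toℕ (inject≤′ i k≤′m) ≡ toℕ i
toℕ-inject≤′ i ≤′-refl          = refl
toℕ-inject≤′ i (≤′-step k≤′m) = trans (toℕ-inject₁ _) (toℕ-inject≤′ i k≤′m)

inject≤′≡inject≤ : ∀ {k m} (i : Fin k) (k≤m : k ≤ m) → inject≤′ i (≤⇒≤′ k≤m) ≡ inject≤ i k≤m
inject≤′≡inject≤ i k≤m =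
  toℕ-injective (trans (toℕ-inject≤′ i (≤⇒≤′ k≤m)) (sym (toℕ-inject≤ i k≤m)))

module _ {c ℓ : Level} (F : Field c ℓ) where
  open Field F using (Carrier; 0#; 1#; -_)

  infix 4 _≋_
  infixl 8 _[_]

  _≋_ : ∀ {m} → Poly F m → Poly F m → Set (c ⊔ ℓ)
  _≋_ = _~_ F

  _[_] : ∀ {m k} → Poly F m → (Fin m → Poly F k) → Poly F k
  p [ θ ] = subst F p θ

  ≋-setoid : ℕ → Setoid c (c ⊔ ℓ)
  ≋-setoid m = record
    { Carrier       = Poly F m
    ; _≈_           = _≋_
    ; isEquivalence = record { refl = ~-refl ; sym = ~-sym ; trans = ~-trans }
    }

  ≡⇒≋ : ∀ {m} {p q : Poly F m} → p ≡ q → p ≋ q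
  ≡⇒≋ refl = ~-refl

  ⊕-identityʳ : ∀ {m} (p : Poly F m) → p ⊕ con 0# ≋ p
  ⊕-identityʳ p = ~-trans (⊕-comm _ _) (⊕-idˡ p)

  ⊖-⊕-cancel : ∀ {m} (p q : Poly F m) → _⊖_ F p q ⊕ q ≋ p
  ⊖-⊕-cancel {m} p q = begin
    (p ⊕ con (- 1#) ⊗ q) ⊕ q   ≈⟨ ⊕-assoc _ _ _ ⟩
    p ⊕ (con (- 1#) ⊗ q ⊕ q)   ≈⟨ ⊕-cong ~-refl (~-trans (⊕-comm _ _) (⊕-invʳ q)) ⟩
    p ⊕ con 0#                 ≈⟨ ⊕-identityʳ p ⟩
    p                          ∎
    where open SetoidReasoning (≋-setoid m)

  gateOp : ∀ {n m k} → Gate F n m → Poly F k → Poly F k → Poly F k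
  gateOp (plus _ _)  = _⊕_
  gateOp (times _ _) = _⊗_

  leftChild rightChild : ∀ {n m} → Gate F n m → Node F n m
  leftChild (plus u _)   = u
  leftChild (times u _)  = u
  rightChild (plus _ w)  = w
  rightChild (times _ w) = w

  withChildren : ∀ {n m N M} → Gate F n m → Node F N M → Node F N M → Gate F N M
  withChildren (plus _ _)  = plus
  withChildren (times _ _) = times

  gateExpr-gateOp : ∀ {n m k} (ρ : Fin n → Poly F k) (σ : Fin m → Poly F k) (g : Gate F n m) →
    gateExpr F ρ σ g ≡ gateOp g (label F ρ σ (leftChild g)) (label F ρ σ (rightChild g))
  gateExpr-gateOp ρ σ (plus _ _)  = refl
  gateExpr-gateOp ρ σ (times _ _) = refl

  gateExpr-withChildren : ∀ {n m N M k} (ρ : Fin N → Poly F k) (σ : Fin M → Poly F k)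
    (g : Gate F n m) (u w : Node F N M) →
    gateExpr F ρ σ (withChildren g u w) ≡ gateOp g (label F ρ σ u) (label F ρ σ w)
  gateExpr-withChildren ρ σ (plus _ _)  u w = refl
  gateExpr-withChildren ρ σ (times _ _) u w = refl

  subst-gateOp : ∀ {n m k k′} (g : Gate F n m) (p q : Poly F k) (θ : Fin k → Poly F k′) →
    gateOp g p q [ θ ] ≡ gateOp g (p [ θ ]) (q [ θ ])
  subst-gateOp (plus _ _)  p q θ = refl
  subst-gateOp (times _ _) p q θ = refl

  gateOp-cong : ∀ {n m k} (g : Gate F n m) {p p′ q q′ : Poly F k} →
    p ≋ p′ → q ≋ q′ → gateOp g p q ≋ gateOp g p′ q′
  gateOp-cong (plus _ _)  = ⊕-cong
  gateOp-cong (times _ _) = ⊗-cong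

  gateOp-onlyVarsBelow : ∀ {n m k B} (g : Gate F n m) {p q : Poly F k} →
    OnlyVarsBelow F B p → OnlyVarsBelow F B q → OnlyVarsBelow F B (gateOp g p q)
  gateOp-onlyVarsBelow (plus _ _)  = _⊕_
  gateOp-onlyVarsBelow (times _ _) = _⊗_

  gatePoly : ∀ {N M} → Circuit F N M → Gate F N M → Poly F N
  gatePoly D = gateExpr F var (lookup (gatePolys F D))

  wkNode : ∀ {N M} → Node F N M → Node F N (suc M)
  wkNode (inp j)  = inp j
  wkNode (cst a)  = cst a
  wkNode (gate j) = gate (inject₁ j)

  wkGate : ∀ {N M} → Gate F N M → Gate F N (suc M)
  wkGate (plus u w)  = plus (wkNode u) (wkNode w)
  wkGate (times u w) = times (wkNode u) (wkNode w)

  nodePoly-wkNode : ∀ {N M} (D : Circuit F N M) (h : Gate F N M) (u : Node F N M) →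
    nodePoly F (D ▷ h) (wkNode u) ≡ nodePoly F D u
  nodePoly-wkNode D h (inp j)  = refl
  nodePoly-wkNode D h (cst a)  = refl
  nodePoly-wkNode D h (gate j) = lookup-∷ʳ-inject₁ (gatePolys F D) _ j

  gatePoly-wkGate : ∀ {N M} (D : Circuit F N M) (h g : Gate F N M) →
    gatePoly (D ▷ h) (wkGate g) ≡ gatePoly D g
  gatePoly-wkGate D h (plus u w)  = cong₂ _⊕_ (nodePoly-wkNode D h u) (nodePoly-wkNode D h w)
  gatePoly-wkGate D h (times u w) = cong₂ _⊗_ (nodePoly-wkNode D h u) (nodePoly-wkNode D h w)

  nodePoly-fromℕ : ∀ {N M} (D : Circuit F N M) (g : Gate F N M) →
    nodePoly F (D ▷ g) (gate (fromℕ M)) ≡ gatePoly D g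
  nodePoly-fromℕ D g = lookup-∷ʳ-fromℕ (gatePolys F D) _

  prefix : ∀ {n k m} → Circuit F n m → k ≤′ m → Circuit F n k
  prefix C       ≤′-refl          = C
  prefix (C ▷ g) (≤′-step k≤′m) = prefix C k≤′m

  gateEqs-prefix : ∀ {n k m K} (ρ : Fin n → Poly F K) (C : Circuit F n m) (k≤′m : k ≤′ m)
    (σ : Fin m → Poly F K) (i : Fin k) →
    lookup (gateEqs F ρ C σ) (inject≤′ i k≤′m)
      ≡ lookup (gateEqs F ρ (prefix C k≤′m) (λ j → σ (inject≤′ j k≤′m))) i
  gateEqs-prefix ρ C       ≤′-refl          σ i = refl
  gateEqs-prefix ρ (C ▷ g) (≤′-step k≤′m) σ i =
    trans (lookup-∷ʳ-inject₁ (gateEqs F ρ C (λ j → σ (inject₁ j))) _ (inject≤′ i k≤′m))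
          (gateEqs-prefix ρ C k≤′m (λ j → σ (inject₁ j)) i)

  -- θ stands for the local encoding G, with x_j written ρ j.
  module Decoding {n N M} (θ : Fin N → Poly F M) (ρ : Fin n → Poly F M) (α : Fin n → Carrier)
                  (xin : Fin n → Fin N) (θ-xin : ∀ j → θ (xin j) ≡ _⊖_ F (ρ j) (con (α j)))
                  (B : ℕ) (xin<B : ∀ j → toℕ (xin j) < B) where

    record Decoder {m} (σ : Fin m → Poly F M) : Set (c ⊔ ℓ) where
      field
        circuit        : Circuit F N (m * 4)
        outputs        : Vec (Node F N (m * 4)) m
        output-below   : ∀ i → OnlyVarsBelow F B (nodePoly F circuit (lookup outputs i))
        output-decodes : ∀ i → nodePoly F circuit (lookup outputs i) [ θ ] ≋ σ i

      multiCircuit : MultiCircuit F N m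
      multiCircuit = record { size = m * 4 ; gates = circuit ; outputs = outputs }

      outputPoly-dependsOnlyOnFirst : ∀ i →
        DependsOnlyOnFirst F B (lookup (outputPolys F multiCircuit) i)
      outputPoly-dependsOnlyOnFirst i =
        _ , output-below i , ≡⇒≋ (lookup-map i (nodePoly F circuit) outputs)

      outputPoly-decodes : ∀ i → lookup (outputPolys F multiCircuit) i [ θ ] ≋ σ i
      outputPoly-decodes i =
        ~-trans (≡⇒≋ (cong _[ θ ] (lookup-map i (nodePoly F circuit) outputs))) (output-decodes i)

    open Decoder public

    module Extension {m} (σ : Fin (suc m) → Poly F M) (D : Decoder (λ j → σ (inject₁ j))) where
      τ : Fin m → Poly F M
      τ j = σ (inject₁ j)

      source : Node F n m → Node F N (m * 4)
      source (inp j)  = inp (xin j)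
      source (cst a)  = cst a
      source (gate j) = lookup (outputs D) j

      -- adding 0 for constants and gates keeps every step at exactly four gates
      offset : Node F n m → Carrier
      offset (inp j)  = α j
      offset (cst a)  = 0#
      offset (gate j) = 0#

      childGate : Node F n m → Gate F N (m * 4)
      childGate u = plus (source u) (cst (offset u))

      childGate-below : ∀ u → OnlyVarsBelow F B (gatePoly (circuit D) (childGate u))
      childGate-below (inp j)  = var (xin j) (xin<B j) ⊕ con (α j)
      childGate-below (cst a)  = con a ⊕ con 0#
      childGate-below (gate j) = output-below D j ⊕ con 0#

      childGate-decodes : ∀ u → gatePoly (circuit D) (childGate u) [ θ ] ≋ label F ρ τ u
      childGate-decodes (inp j)  = ~-trans (⊕-cong (≡⇒≋ (θ-xin j)) ~-refl) (⊖-⊕-cancel (ρ j) (con (α j)))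
      childGate-decodes (cst a)  = ⊕-identityʳ (con a)
      childGate-decodes (gate j) = ~-trans (⊕-identityʳ _) (output-decodes D j)

      module _ (g : Gate F n m) (v : Fin N) where
        leftPoly rightPoly : Poly F N
        leftPoly  = gatePoly (circuit D) (childGate (leftChild g))
        rightPoly = gatePoly (circuit D) (childGate (rightChild g))

        gate₁ : Gate F N (m * 4)
        gate₁ = childGate (leftChild g)

        gate₂ : Gate F N (suc (m * 4))
        gate₂ = wkGate (childGate (rightChild g))

        gate₃ : Gate F N (suc (suc (m * 4)))
        gate₃ = withChildren g (gate (inject₁ (fromℕ _))) (gate (fromℕ _))

        gate₄ : Gate F N (suc (suc (suc (m * 4))))
        gate₄ = plus (inp v) (gate (fromℕ _))

        D₁ : Circuit F N (suc (m * 4))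
        D₁ = circuit D ▷ gate₁

        D₂ : Circuit F N (suc (suc (m * 4)))
        D₂ = D₁ ▷ gate₂

        D₃ : Circuit F N (suc (suc (suc (m * 4))))
        D₃ = D₂ ▷ gate₃

        stepCircuit : Circuit F N (suc m * 4)
        stepCircuit = D₃ ▷ gate₄

        wk⁴ : Node F N (m * 4) → Node F N (suc m * 4)
        wk⁴ u = wkNode (wkNode (wkNode (wkNode u)))

        stepOutputs : Vec (Node F N (suc m * 4)) (suc m)
        stepOutputs = map wk⁴ (outputs D) ∷ʳ gate (fromℕ _)

        nodePoly-wk⁴ : ∀ u → nodePoly F stepCircuit (wk⁴ u) ≡ nodePoly F (circuit D) u
        nodePoly-wk⁴ u =
          trans (nodePoly-wkNode D₃ gate₄ (wkNode (wkNode (wkNode u))))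
          (trans (nodePoly-wkNode D₂ gate₃ (wkNode (wkNode u)))
          (trans (nodePoly-wkNode D₁ gate₂ (wkNode u))
                 (nodePoly-wkNode (circuit D) gate₁ u)))

        stepOutput-inject₁ : ∀ j →
          nodePoly F stepCircuit (lookup stepOutputs (inject₁ j)) ≡ nodePoly F (circuit D) (lookup (outputs D) j)
        stepOutput-inject₁ j =
          trans (cong (nodePoly F stepCircuit) (trans (lookup-∷ʳ-inject₁ (map wk⁴ (outputs D)) _ j)
                                                      (lookup-map j wk⁴ (outputs D))))
                (nodePoly-wk⁴ (lookup (outputs D) j))

        stepOutput-fromℕ : nodePoly F stepCircuit (lookup stepOutputs (fromℕ m))
                             ≡ var v ⊕ gateOp g leftPoly rightPoly
        stepOutput-fromℕ =
          trans (cong (nodePoly F stepCircuit) (lookup-∷ʳ-fromℕ (map wk⁴ (outputs D)) _))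
          (trans (nodePoly-fromℕ D₃ gate₄)
          (cong (var v ⊕_)
            (trans (nodePoly-fromℕ D₂ gate₃)
            (trans (gateExpr-withChildren var (lookup (gatePolys F D₂)) g _ _)
                   (cong₂ (gateOp g)
                     (trans (nodePoly-wkNode D₁ gate₂ (gate (fromℕ _))) (nodePoly-fromℕ (circuit D) gate₁))
                     (trans (nodePoly-fromℕ D₁ gate₂) (gatePoly-wkGate (circuit D) gate₁ (childGate (rightChild g)))))))))

        extend : θ v ≡ _⊖_ F (σ (fromℕ m)) (gateExpr F ρ τ g) → toℕ v < B → Decoder σ
        extend θ-v v<B = record
          { circuit        = stepCircuit
          ; outputs        = stepOutputs
          ; output-below   = below
          ; output-decodes = decodes
          }
          where
          below : ∀ i → OnlyVarsBelow F B (nodePoly F stepCircuit (lookup stepOutputs i))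
          below i with view i
          ... | ‵fromℕ rewrite stepOutput-fromℕ =
            var v v<B ⊕ gateOp-onlyVarsBelow g (childGate-below (leftChild g)) (childGate-below (rightChild g))
          ... | ‵inject₁ j rewrite stepOutput-inject₁ j = output-below D j

          lastDecodes : (var v ⊕ gateOp g leftPoly rightPoly) [ θ ] ≋ σ (fromℕ m)
          lastDecodes = begin
            θ v ⊕ gateOp g leftPoly rightPoly [ θ ]
              ≡⟨ cong (θ v ⊕_) (subst-gateOp g leftPoly rightPoly θ) ⟩
            θ v ⊕ gateOp g (leftPoly [ θ ]) (rightPoly [ θ ])
              ≈⟨ ⊕-cong (≡⇒≋ θ-v) (gateOp-cong g (childGate-decodes (leftChild g))
                                                  (childGate-decodes (rightChild g))) ⟩
            _⊖_ F (σ (fromℕ m)) (gateExpr F ρ τ g) ⊕ gateOp g (label F ρ τ (leftChild g)) (label F ρ τ (rightChild g))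
              ≡⟨ cong (_⊖_ F (σ (fromℕ m)) (gateExpr F ρ τ g) ⊕_) (sym (gateExpr-gateOp ρ τ g)) ⟩
            _⊖_ F (σ (fromℕ m)) (gateExpr F ρ τ g) ⊕ gateExpr F ρ τ g
              ≈⟨ ⊖-⊕-cancel _ _ ⟩
            σ (fromℕ m) ∎
            where open SetoidReasoning (≋-setoid M)

          decodes : ∀ i → nodePoly F stepCircuit (lookup stepOutputs i) [ θ ] ≋ σ i
          decodes i with view i
          ... | ‵fromℕ     rewrite stepOutput-fromℕ    = lastDecodes
          ... | ‵inject₁ j rewrite stepOutput-inject₁ j = output-decodes D j

    decode : ∀ {m} (C : Circuit F n m) (σ : Fin m → Poly F M) (yin : Fin m → Fin N) →
      (∀ i → θ (yin i) ≡ lookup (gateEqs F ρ C σ) i) → (∀ i → toℕ (yin i) < B) → Decoder σ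
    decode [] σ yin θ-yin yin<B = record
      { circuit = [] ; outputs = [] ; output-below = λ () ; output-decodes = λ () }
    decode {suc m} (C ▷ g) σ yin θ-yin yin<B =
      Extension.extend σ
        (decode C (λ j → σ (inject₁ j)) (λ j → yin (inject₁ j))
          (λ j → trans (θ-yin (inject₁ j)) (lookup-∷ʳ-inject₁ (gateEqs F ρ C _) _ j))
          (λ j → yin<B (inject₁ j)))
        g (yin (fromℕ m))
        (trans (θ-yin (fromℕ m)) (lookup-∷ʳ-fromℕ (gateEqs F ρ C _) _))
        (yin<B (fromℕ m))

    decodePrefix : ∀ {k m} (C : Circuit F n m) (k≤′m : k ≤′ m) (σ : Fin m → Poly F M) (yin : Fin m → Fin N) →
      (∀ i → θ (yin i) ≡ lookup (gateEqs F ρ C σ) i) →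
      (∀ i → toℕ (yin (inject≤′ i k≤′m)) < B) →
      Decoder (λ i → σ (inject≤′ i k≤′m))
    decodePrefix C k≤′m σ yin θ-yin yin<B =
      decode (prefix C k≤′m) _ (λ i → yin (inject≤′ i k≤′m))
        (λ i → trans (θ-yin _) (gateEqs-prefix ρ C k≤′m σ i)) yin<B

  module LocalEncoding {n s} (Φ : Circuit F n (suc s)) (α : Vec Carrier n) (β : Carrier) where
    G : Fin (n + suc s + 1) → Poly F (n + suc s)
    G = lookup (localEncoding F Φ α β)

    x : Fin n → Poly F (n + suc s)
    x j = var (j ↑ˡ suc s)

    y : Fin (suc s) → Poly F (n + suc s)
    y i = var (n ↑ʳ i)

    xEqs : Vec (Poly F (n + suc s)) n
    xEqs = tabulate (λ j → _⊖_ F (x j) (con (lookup α j)))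

    xCoord : Fin n → Fin (n + suc s + 1)
    xCoord j = (j ↑ˡ suc s) ↑ˡ 1

    gateCoord : Fin (suc s) → Fin (n + suc s + 1)
    gateCoord i = (n ↑ʳ i) ↑ˡ 1

    G-xCoord : ∀ j → G (xCoord j) ≡ _⊖_ F (x j) (con (lookup α j))
    G-xCoord j = trans (lookup-++ˡ (xEqs ++ gateEqs F x Φ y) _ (j ↑ˡ suc s))
                       (trans (lookup-++ˡ xEqs (gateEqs F x Φ y) j) (lookup∘tabulate _ j))

    G-gateCoord : ∀ i → G (gateCoord i) ≡ lookup (gateEqs F x Φ y) i
    G-gateCoord i = trans (lookup-++ˡ (xEqs ++ gateEqs F x Φ y) _ (n ↑ʳ i)) (lookup-++ʳ xEqs _ i)

    xCoord<n+k : ∀ k j → toℕ (xCoord j) < n + k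
    xCoord<n+k k j = <-≤-trans
      (≤-reflexive (cong suc (trans (toℕ-↑ˡ (j ↑ˡ suc s) 1) (toℕ-↑ˡ j (suc s)))))
      (<-≤-trans (toℕ<n j) (m≤m+n n k))

    gateCoord<n+k : ∀ {k} (k≤′s : k ≤′ suc s) i → toℕ (gateCoord (inject≤′ i k≤′s)) < n + k
    gateCoord<n+k k≤′s i = <-≤-trans
      (≤-reflexive (cong suc (trans (toℕ-↑ˡ (n ↑ʳ _) 1)
                             (trans (toℕ-↑ʳ n _) (cong (n +_) (toℕ-inject≤′ i k≤′s))))))
      (+-monoʳ-< n (toℕ<n i))

    module _ {k} (k≤′s : k ≤′ suc s) where
      open Decoding G x (lookup α) xCoord G-xCoord (n + k) (xCoord<n+k k) public

      prefixDecoder : Decoder (λ i → y (inject≤′ i k≤′s))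
      prefixDecoder = decodePrefix Φ k≤′s y gateCoord G-gateCoord (gateCoord<n+k k≤′s)

lemma3p5 : ∃ℕω λ C →
    ∀ {c ℓ} (F : Field c ℓ) (n s : ℕ) (Φ : Circuit F n (suc s))
      (α : Vec (Field.Carrier F) n) (β : Field.Carrier F)
      (k : ℕ) → 1 ≤ k → (k≤s : k ≤ suc s) →
      Σ (MultiCircuit F (n + suc s + 1) k) λ Ψ →
        (MultiCircuit.size Ψ ≤ C * k)
        × (∀ (i : Fin k) →
             DependsOnlyOnFirst F (n + k) (lookup (outputPolys F Ψ) i)
             × _~_ F (subst F (lookup (outputPolys F Ψ) i) (lookup (localEncoding F Φ α β)))
                     (var (n ↑ʳ inject≤ i k≤s)))
lemma3p5 = 4 , λ F n s Φ α β k _ k≤s →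
  let open LocalEncoding F Φ α β
      D = prefixDecoder (≤⇒≤′ k≤s)
  in multiCircuit (≤⇒≤′ k≤s) D
   , ≤-reflexive (*-comm k 4)
   , λ i → outputPoly-dependsOnlyOnFirst (≤⇒≤′ k≤s) D i
         , ~-trans (outputPoly-decodes (≤⇒≤′ k≤s) D i)
                   (≡⇒≋ F (cong (λ j → var (n ↑ʳ j)) (inject≤′≡inject≤ i k≤s)))
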